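{- Let $H$ be an induced subgraph of a finite simple graph $G$, and let $s$ be an integer. If $\pi^{c}(H)\le n(H)-s$, then $\pi^{c}(G)\le n(G)-s$.
   Context: $n(\cdot)$ denotes the number of vertices. A configuration of cops on a graph is a function $C$ from its vertices to $\mathbb{Z}_{\ge 0}$ of size $\sum_v C(v)$. A pebbling step from a vertex $u$ with at least two cops to an adjacent vertex $v$ removes two cops from $u$ and adds one cop to $v$. In the cops and robbers pebbling game, cops are placed according to $C$, then a robber chooses a starting vertex; thereafter, in each turn the cops make pebbling steps, after which the robber either moves to an adjacent vertex or stays put. The robber is captured when he occupies a vertex holding at least one cop. The cop pebbling number $\pi^{c}(G)$ is the minimum $m$ such that some configuration of size $m$ allows the cops to capture the robber regardless of how he starts and moves. -}

module Defs where

open import Data.Nat using (ℕ; _+_; _∸_; _≤_; _<_)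
open import Data.Integer as ℤ using (ℤ; +_)
open import Data.Fin using (Fin)
open import Data.Bool using (Bool; true; false)
open import Data.List using (map; allFin)
open import Data.Nat.ListAction using (sum)
open import Data.Product using (Σ; ∃; _×_; _,_)
open import Data.Sum using (_⊎_)
open import Relation.Nullary using (¬_)
open import Relation.Binary.PropositionalEquality using (_≡_)
open import Relation.Binary.Construct.Closure.ReflexiveTransitive using (Star)
open import Function.Definitions using (Injective)

record Graph : Set where
  field
    n     : ℕ
    adj   : Fin n → Fin n → Bool
    sym   : ∀ u v → adj u v ≡ adj v u
    irref : ∀ u → adj u u ≡ false
open Graph public

Adj : (G : Graph) → Fin (n G) → Fin (n G) → Set
Adj G u v = adj G u v ≡ true

InducedSubgraph : Graph → Graph → Set
InducedSubgraph H G =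
  Σ (Fin (n H) → Fin (n G)) λ f →
    Injective _≡_ _≡_ f × (∀ a b → adj H a b ≡ adj G (f a) (f b))

Config : Graph → Set
Config G = Fin (n G) → ℕ

size : (G : Graph) → Config G → ℕ
size G C = sum (map C (allFin (n G)))

-- One pebbling step from u to adjacent v (u ≠ v since G is loopless).
Step : (G : Graph) → Config G → Config G → Set
Step G C C' = ∃ λ u → ∃ λ v → Adj G u v × 2 ≤ C u
  × C' u ≡ C u ∸ 2 × C' v ≡ C v + 1
  × (∀ w → ¬ w ≡ u → ¬ w ≡ v → C' w ≡ C w)

Steps : (G : Graph) → Config G → Config G → Set
Steps G = Star (Step G)

-- CopWin G C r : the cops, holding configuration C and about to move,
-- with the robber at r, can force capture in finitely many rounds.
data CopWin (G : Graph) : Config G → Fin (n G) → Set where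
  caught : ∀ {C r} → 0 < C r → CopWin G C r
  round  : ∀ {C C' r} → Steps G C C' →
           (0 < C' r ⊎ (∀ r' → (r' ≡ r ⊎ Adj G r r') → CopWin G C' r')) →
           CopWin G C r

Winning : (G : Graph) → Config G → Set
Winning G C = ∀ r → CopWin G C r

-- π^c(G) ≤ k  (k an integer): some winning configuration has size ≤ k.
-- (π^c(G) is the minimum size of a winning configuration.)
CopPebLE : Graph → ℤ → Set
CopPebLE G k = ∃ λ C → Winning G C × (+ size G C) ℤ.≤ k

-- Keep the cops' configuration on the copy of H and add one cop on every
-- vertex of G outside it.  A robber who ever steps off the copy is captured at
-- once, and inside the copy the cops replay their strategy for H, since H is
-- induced.  The new configuration has n(G) − n(H) more cops than the old one,
-- so a bound of the form n(H) − s becomes n(G) − s.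
{-# OPTIONS --safe #-}
module Submission where

open import Defs hiding (sym)
open import Data.Integer as ℤ using (ℤ; +_; _-_)
import Data.Integer.Properties as ℤ
open import Data.Integer.Solver using (module +-*-Solver)
open import Data.Nat using (ℕ; zero; suc; _+_; _∸_; _≤_; _<_; z≤n)
open import Data.Nat.Properties
  using (+-identityʳ; +-assoc; ≤-reflexive; m∸n+n≡m; +-0-commutativeMonoid)
open import Data.Nat.ListAction using (sum)
open import Algebra.Properties.CommutativeMonoid.Sum +-0-commutativeMonoid
  using (sum-cong-≗; ∑-distrib-+; sum-replicate-zero) renaming (sum to ∑)
open import Data.Fin using (Fin; zero; suc)
open import Data.Fin.Properties using (any?; suc-injective; 0≢1+n) renaming (_≟_ to _≟ᶠ_)
open import Data.List using (map; allFin; tabulate)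
open import Data.List.Properties using (map-tabulate)
open import Data.Product using (_,_)
open import Data.Sum using (_⊎_; inj₁; inj₂)
open import Function using (_∘_; id)
open import Function.Definitions using (Injective)
open import Relation.Nullary using (yes; no)
open import Relation.Nullary.Negation using (contradiction; ¬∃⟶∀¬)
open import Relation.Binary.PropositionalEquality
open import Relation.Binary.Construct.Closure.ReflexiveTransitive using (gmap)

sum-tabulate : ∀ {n} (g : Fin n → ℕ) → sum (tabulate g) ≡ ∑ g
sum-tabulate {zero}  g = refl
sum-tabulate {suc n} g = cong (_+_ (g zero)) (sum-tabulate (g ∘ suc))

sum-map-allFin : ∀ {n} (g : Fin n → ℕ) → sum (map g (allFin n)) ≡ ∑ g
sum-map-allFin g = trans (cong sum (map-tabulate id g)) (sum-tabulate g)

∑-const-1 : ∀ n → ∑ {n} (λ _ → 1) ≡ n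
∑-const-1 zero    = refl
∑-const-1 (suc n) = cong suc (∑-const-1 n)

δ : ∀ {n} → Fin n → ℕ → Fin n → ℕ
δ zero    x zero    = x
δ zero    x (suc _) = 0
δ (suc p) x zero    = 0
δ (suc p) x (suc v) = δ p x v

δ-same : ∀ {n} (p : Fin n) x → δ p x p ≡ x
δ-same zero    x = refl
δ-same (suc p) x = δ-same p x

δ-≢ : ∀ {n} {p v : Fin n} x → p ≢ v → δ p x v ≡ 0
δ-≢ {p = zero}  {zero}  x p≢v = contradiction refl p≢v
δ-≢ {p = zero}  {suc v} x p≢v = refl
δ-≢ {p = suc p} {zero}  x p≢v = refl
δ-≢ {p = suc p} {suc v} x p≢v = δ-≢ x (p≢v ∘ cong suc)

∑-δ : ∀ {n} (p : Fin n) x → ∑ (δ p x) ≡ x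
∑-δ {suc n} zero    x = trans (cong (_+_ x) (sum-replicate-zero n)) (+-identityʳ x)
∑-δ {suc n} (suc p) x = ∑-δ p x

-- push f h v is the total weight under h of the fibre of f over v.
push : ∀ {m n} → (Fin m → Fin n) → (Fin m → ℕ) → Fin n → ℕ
push {zero}  f h v = 0
push {suc m} f h v = δ (f zero) (h zero) v + push (f ∘ suc) (h ∘ suc) v

∑-push : ∀ {m n} (f : Fin m → Fin n) h → ∑ (push f h) ≡ ∑ h
∑-push {zero}  {n} f h = sum-replicate-zero n
∑-push {suc m}     f h = trans (∑-distrib-+ (δ (f zero) (h zero)) _)
  (cong₂ _+_ (∑-δ (f zero) (h zero)) (∑-push (f ∘ suc) (h ∘ suc)))

push-outside : ∀ {m n} (f : Fin m → Fin n) h {v} → (∀ a → f a ≢ v) → push f h v ≡ 0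
push-outside {zero}  f h v∉ = refl
push-outside {suc m} f h v∉ =
  cong₂ _+_ (δ-≢ (h zero) (v∉ zero)) (push-outside (f ∘ suc) (h ∘ suc) (v∉ ∘ suc))

push-injective : ∀ {m n} {f : Fin m → Fin n} h → Injective _≡_ _≡_ f →
                 ∀ a → push f h (f a) ≡ h a
push-injective {suc m} {f = f} h f-inj zero = trans
  (cong₂ _+_ (δ-same (f zero) (h zero))
             (push-outside (f ∘ suc) (h ∘ suc) (λ a → 0≢1+n ∘ sym ∘ f-inj)))
  (+-identityʳ (h zero))
push-injective {suc m} {f = f} h f-inj (suc a) =
  cong₂ _+_ (δ-≢ (h zero) (0≢1+n ∘ f-inj)) (push-injective (h ∘ suc) (suc-injective ∘ f-inj) a)

m+p≡n+q⇒n≤p-s⇒m≤q-s : ∀ {m n p q : ℕ} (s : ℤ) →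
                       m + p ≡ n + q → + n ℤ.≤ + p - s → + m ℤ.≤ + q - s
m+p≡n+q⇒n≤p-s⇒m≤q-s {m} {n} {p} {q} s m+p≡n+q n≤p-s = begin
  + m                        ≡⟨ solve 2 (λ m p → m := m :+ p :- p) refl (+ m) (+ p) ⟩
  + m ℤ.+ + p - + p          ≡⟨ cong (λ k → + k - + p) m+p≡n+q ⟩
  + n ℤ.+ + q - + p          ≡⟨ solve 3 (λ n q p → n :+ q :- p := n :+ (q :- p))
                                        refl (+ n) (+ q) (+ p) ⟩
  + n ℤ.+ (+ q - + p)        ≤⟨ ℤ.+-monoˡ-≤ (+ q - + p) n≤p-s ⟩
  (+ p - s) ℤ.+ (+ q - + p)  ≡⟨ solve 3 (λ p q s → (p :- s) :+ (q :- p) := q :- s)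
                                        refl (+ p) (+ q) s ⟩
  + q - s                    ∎
  where
  open ℤ.≤-Reasoning
  open +-*-Solver

module Extension (G H : Graph) (f : Fin (n H) → Fin (n G)) (f-inj : Injective _≡_ _≡_ f)
                 (f-adj : ∀ a b → adj H a b ≡ adj G (f a) (f b)) where

  data ImageView : Fin (n G) → Set where
    image   : ∀ a → ImageView (f a)
    outside : ∀ {v} → (∀ a → f a ≢ v) → ImageView v

  imageView : ∀ v → ImageView v
  imageView v with any? (λ a → f a ≟ᶠ v)
  ... | yes (a , refl) = image a
  ... | no v∉          = outside (¬∃⟶∀¬ v∉)

  #preimages : Fin (n G) → ℕ
  #preimages = push f (λ _ → 1)

  extend : Config H → Config G
  extend C v = push f C v + (1 ∸ #preimages v)

  extend-image : ∀ C a → extend C (f a) ≡ C a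
  extend-image C a rewrite push-injective C f-inj a | push-injective (λ _ → 1) f-inj a =
    +-identityʳ (C a)

  extend-outside : ∀ C {v} → (∀ a → f a ≢ v) → extend C v ≡ 1
  extend-outside C v∉ rewrite push-outside f C v∉ | push-outside f (λ _ → 1) v∉ = refl

  0<extend-outside : ∀ C {v} → (∀ a → f a ≢ v) → 0 < extend C v
  0<extend-outside C v∉ = ≤-reflexive (sym (extend-outside C v∉))

  extend-step : ∀ {C C′} → Step H C C′ → Step G (extend C) (extend C′)
  extend-step {C} {C′} (u , v , u~v , 2≤Cu , C′u , C′v , C′-rest) =
    f u , f v , trans (sym (f-adj u v)) u~v ,
    subst (2 ≤_) (sym (extend-image C u)) 2≤Cu ,
    trans (extend-image C′ u) (trans C′u (cong (_∸ 2) (sym (extend-image C u)))) ,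
    trans (extend-image C′ v) (trans C′v (cong (_+ 1) (sym (extend-image C v)))) ,
    rest
    where
    rest : ∀ w → w ≢ f u → w ≢ f v → extend C′ w ≡ extend C w
    rest w w≢fu w≢fv with imageView w
    ... | image a   = trans (extend-image C′ a)
                        (trans (C′-rest a (w≢fu ∘ cong f) (w≢fv ∘ cong f)) (sym (extend-image C a)))
    ... | outside w∉ = trans (extend-outside C′ w∉) (sym (extend-outside C w∉))

  extend-copWin : ∀ {C r} → CopWin H C r → CopWin G (extend C) (f r)
  extend-copWin {C} {r} (caught 0<Cr) = caught (subst (0 <_) (sym (extend-image C r)) 0<Cr)
  extend-copWin {r = r} (round {C' = C′} C↝C′ (inj₁ 0<C′r)) =
    round (gmap extend extend-step C↝C′) (inj₁ (subst (0 <_) (sym (extend-image C′ r)) 0<C′r))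
  extend-copWin {r = r} (round {C' = C′} C↝C′ (inj₂ next)) =
    round (gmap extend extend-step C↝C′) (inj₂ next′)
    where
    next′ : ∀ r′ → r′ ≡ f r ⊎ Adj G (f r) r′ → CopWin G (extend C′) r′
    next′ r′ move with imageView r′
    ... | outside r′∉ = caught (0<extend-outside C′ r′∉)
    ... | image a with move
    ...   | inj₁ fa≡fr = extend-copWin (next a (inj₁ (f-inj fa≡fr)))
    ...   | inj₂ fr~fa = extend-copWin (next a (inj₂ (trans (f-adj r a) fr~fa)))

  extend-winning : ∀ {C} → Winning H C → Winning G (extend C)
  extend-winning {C} win v with imageView v
  ... | image a     = extend-copWin (win a)
  ... | outside v∉  = caught (0<extend-outside C v∉)

  #preimages≤1 : ∀ v → #preimages v ≤ 1
  #preimages≤1 v with imageView v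
  ... | image a    = ≤-reflexive (push-injective (λ _ → 1) f-inj a)
  ... | outside v∉ = subst (_≤ 1) (sym (push-outside f (λ _ → 1) v∉)) z≤n

  ∑-1∸#preimages+nH≡nG : ∑ (λ v → 1 ∸ #preimages v) + n H ≡ n G
  ∑-1∸#preimages+nH≡nG = begin
    ∑ (λ v → 1 ∸ #preimages v) + n H
      ≡⟨ cong (_+_ (∑ (λ v → 1 ∸ #preimages v))) ∑-#preimages ⟨
    ∑ (λ v → 1 ∸ #preimages v) + ∑ #preimages
      ≡⟨ ∑-distrib-+ (λ v → 1 ∸ #preimages v) #preimages ⟨
    ∑ (λ v → (1 ∸ #preimages v) + #preimages v)
      ≡⟨ sum-cong-≗ (λ v → m∸n+n≡m (#preimages≤1 v)) ⟩
    ∑ {n G} (λ _ → 1)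
      ≡⟨ ∑-const-1 (n G) ⟩
    n G ∎
    where
    open ≡-Reasoning
    ∑-#preimages : ∑ #preimages ≡ n H
    ∑-#preimages = trans (∑-push f (λ _ → 1)) (∑-const-1 (n H))

  size-extend : ∀ C → size G (extend C) + n H ≡ size H C + n G
  size-extend C = begin
    size G (extend C) + n H
      ≡⟨ cong (_+ n H) (trans (sum-map-allFin (extend C)) (∑-distrib-+ (push f C) _)) ⟩
    ∑ (push f C) + ∑ (λ v → 1 ∸ #preimages v) + n H
      ≡⟨ +-assoc (∑ (push f C)) _ (n H) ⟩
    ∑ (push f C) + (∑ (λ v → 1 ∸ #preimages v) + n H)
      ≡⟨ cong₂ _+_ (∑-push f C) ∑-1∸#preimages+nH≡nG ⟩
    ∑ C + n G
      ≡⟨ cong (_+ n G) (sum-map-allFin C) ⟨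
    size H C + n G ∎
    where open ≡-Reasoning

theorem6 : (G H : Graph) → InducedSubgraph H G → (s : ℤ) →
    CopPebLE H ((+ n H) - s) → CopPebLE G ((+ n G) - s)
theorem6 G H (f , f-inj , f-adj) s (C , win , size≤) =
  extend C , extend-winning win , m+p≡n+q⇒n≤p-s⇒m≤q-s s (size-extend C) size≤
  where open Extension G H f f-inj f-adj
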